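{- Let $q$ be a power of an odd prime and let $e\ge 2$ be an integer. The only nonnegative integer solution $(c_1,\dots,c_e)$ of the system \[ \sum_{j=1}^{e}c_j(q^j-2)\equiv 0\pmod{q^e-1},\qquad \sum_{j=1}^{e}c_j=q-1 \] is $(c_1,\dots,c_e)=(1,0,\dots,0,q-2)$. -}

module Defs where

open import Data.Nat using (ℕ; zero; suc; _+_; _*_; _∸_; _^_)
open import Data.Fin using (Fin; toℕ)
open import Data.List using (List; map; allFin)
open import Data.Nat.ListAction using (sum)
open import Relation.Nullary using (¬_; yes; no)
open import Data.Nat using (_≟_)
open import Data.Nat.Primality using (Prime)
open import Data.Product using (∃; _×_)
open import Data.Nat using (_≤_)
open import Relation.Binary.PropositionalEquality using (_≡_)

IsOddPrimePower : ℕ → Set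
IsOddPrimePower q = ∃ λ p → ∃ λ k → Prime p × ¬ (p ≡ 2) × 1 ≤ k × q ≡ p ^ k

Σ[_] : {e : ℕ} → (Fin e → ℕ) → ℕ
Σ[_] {e} f = sum (map f (allFin e))

-- index i : Fin e corresponds to j = toℕ i + 1 ∈ {1,…,e}.
-- Σ_{j=1}^{e} c_j (q^j - 2)   (each q^j ≥ q ≥ 3, so truncated ∸ is exact)
weightedSum : (q : ℕ) {e : ℕ} → (Fin e → ℕ) → ℕ
weightedSum q c = Σ[ (λ i → c i * (q ^ suc (toℕ i) ∸ 2)) ]

claimed : (q e : ℕ) → Fin e → ℕ
claimed q e i with toℕ i
... | zero = 1
... | suc m with suc (suc m) ≟ e
...   | yes _ = q ∸ 2
...   | no _ = 0

module Submission where

-- Read a digit vector d : Fin k → ℕ as the base-q numeral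
--   value q d = d₀ + d₁ q + … + d_{k-1} q^(k-1).
-- Let e ≥ 2, N = q^e − 1, and let c satisfy Σ c = q − 1.  Then
--   weightedSum q c + 2(q − 1) = Σ cⱼ q^(j+1) = q · value q c
--                              = value q (rotate c) + c_{e-1} · N,
-- where rotate c = (c_{e-1}, c₀, …, c_{e-2}) is the cyclic shift (as q · q^(e-1) = 1 + N).
-- Every digit of rotate c is at most Σ c = q − 1, so value q (rotate c) ≤ N, whereas
-- 0 < 2(q − 1) < N.  Hence N ∣ weightedSum q c forces value q (rotate c) = 2(q − 1),
-- whose only base-q representation is (q − 2, 1, 0, …, 0) = rotate (claimed q e);
-- uniqueness of base-q digits gives c = claimed q e.  The same identity applied to
-- claimed q e itself shows that it is a solution.

open import Defs
open import Data.Nat using (ℕ; zero; suc; _+_; _*_; _∸_; _^_; _≤_; _<_; z≤n; s≤s; NonZero; _≟_; _%_)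
open import Data.Nat.Properties
open import Data.Nat.Base using (nonTrivial⇒n>1; >-nonZero; s≤s⁻¹)
open import Data.Nat.DivMod using ([m+kn]%n≡m%n; m<n⇒m%n≡m; n%n≡0)
open import Data.Nat.Divisibility using (_∣_; divides)
open import Data.Nat.Primality using (prime⇒nonTrivial; prime⇒nonZero)
open import Data.Nat.Tactic.RingSolver using (solve-∀)
open import Data.Fin using (Fin; zero; suc; toℕ; inject₁; fromℕ)
open import Data.Fin.Properties using (toℕ-inject₁; toℕ-fromℕ; toℕ<n)
open import Data.List using (map; tabulate)
open import Data.Nat.ListAction using (sum)
open import Data.Product using (∃; _×_; _,_; proj₁; proj₂)
open import Data.Sum using (_⊎_; inj₁; inj₂)
open import Data.Empty using (⊥-elim)
open import Relation.Nullary using (yes; no)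
open import Relation.Binary.PropositionalEquality
open import Function using (_∘_)

-- Finite sums over Fin k, by recursion, so that they unfold one term at a time.
sumFin : {k : ℕ} → (Fin k → ℕ) → ℕ
sumFin {zero}  f = 0
sumFin {suc k} f = f zero + sumFin (f ∘ suc)

Σ≡sumFin : {k : ℕ} (f : Fin k → ℕ) → Σ[ f ] ≡ sumFin f
Σ≡sumFin f = sum-tabulate f (λ i → i)
  where
  sum-tabulate : {k m : ℕ} (f : Fin m → ℕ) (g : Fin k → Fin m) →
                 sum (map f (tabulate g)) ≡ sumFin (f ∘ g)
  sum-tabulate {zero}  f g = refl
  sum-tabulate {suc k} f g = cong (f (g zero) +_) (sum-tabulate f (g ∘ suc))

sumFin-cong : {k : ℕ} {f g : Fin k → ℕ} → (∀ i → f i ≡ g i) → sumFin f ≡ sumFin g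
sumFin-cong {zero}  f≗g = refl
sumFin-cong {suc k} f≗g = cong₂ _+_ (f≗g zero) (sumFin-cong (f≗g ∘ suc))

sumFin-zero : (k : ℕ) → sumFin {k} (λ _ → 0) ≡ 0
sumFin-zero zero    = refl
sumFin-zero (suc k) = sumFin-zero k

sumFin-last : {n : ℕ} (f : Fin (suc n) → ℕ) → sumFin f ≡ sumFin (f ∘ inject₁) + f (fromℕ n)
sumFin-last {zero}  f = +-comm (f zero) 0
sumFin-last {suc n} f rewrite sumFin-last (f ∘ suc) = sym (+-assoc (f zero) _ _)

term≤sumFin : {k : ℕ} (f : Fin k → ℕ) (i : Fin k) → f i ≤ sumFin f
term≤sumFin f zero    = m≤m+n (f zero) _
term≤sumFin f (suc i) = ≤-trans (term≤sumFin (f ∘ suc) i) (m≤n+m _ (f zero))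

sumFin-weights∸2 : {k : ℕ} (c g : Fin k → ℕ) → (∀ i → 2 ≤ g i) →
                   sumFin (λ i → c i * (g i ∸ 2)) + 2 * sumFin c ≡ sumFin (λ i → c i * g i)
sumFin-weights∸2 {zero}  c g g≥2 = refl
sumFin-weights∸2 {suc k} c g g≥2 = begin
    (c₀ * (g₀ ∸ 2) + S) + 2 * (c₀ + C)
  ≡⟨ regroup (c₀ * (g₀ ∸ 2)) S c₀ C ⟩
    (c₀ * (g₀ ∸ 2) + c₀ * 2) + (S + 2 * C)
  ≡⟨ cong₂ _+_ (sym (*-distribˡ-+ c₀ (g₀ ∸ 2) 2))
               (sumFin-weights∸2 (c ∘ suc) (g ∘ suc) (g≥2 ∘ suc)) ⟩
    c₀ * (g₀ ∸ 2 + 2) + sumFin (λ i → c (suc i) * g (suc i))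
  ≡⟨ cong (λ w → c₀ * w + sumFin (λ i → c (suc i) * g (suc i))) (m∸n+n≡m (g≥2 zero)) ⟩
    c₀ * g₀ + sumFin (λ i → c (suc i) * g (suc i)) ∎
  where
  open ≡-Reasoning
  c₀ = c zero
  g₀ = g zero
  S = sumFin (λ i → c (suc i) * (g (suc i) ∸ 2))
  C = sumFin (c ∘ suc)
  regroup : ∀ a b x y → (a + b) + 2 * (x + y) ≡ (a + x * 2) + (b + 2 * y)
  regroup = solve-∀

rotate : {n : ℕ} {A : Set} → (Fin (suc n) → A) → Fin (suc n) → A
rotate {n} d zero    = d (fromℕ n)
rotate     d (suc i) = d (inject₁ i)

last-or-inject₁ : {n : ℕ} (j : Fin (suc n)) → j ≡ fromℕ n ⊎ ∃ λ i → j ≡ inject₁ i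
last-or-inject₁ {zero}  zero    = inj₁ refl
last-or-inject₁ {suc n} zero    = inj₂ (zero , refl)
last-or-inject₁ {suc n} (suc j) with last-or-inject₁ j
... | inj₁ j≡last    = inj₁ (cong suc j≡last)
... | inj₂ (i , j≡i) = inj₂ (suc i , cong suc j≡i)

rotate-reflects : {n : ℕ} {A : Set} (f g : Fin (suc n) → A) →
                  (∀ i → rotate f i ≡ rotate g i) → ∀ j → f j ≡ g j
rotate-reflects f g eq j with last-or-inject₁ j
... | inj₁ refl       = eq zero
... | inj₂ (i , refl) = eq (suc i)

sumFin-rotate : {n : ℕ} (f : Fin (suc n) → ℕ) → sumFin (rotate f) ≡ sumFin f
sumFin-rotate f = trans (+-comm (f (fromℕ _)) _) (sym (sumFin-last f))

module _ (q : ℕ) where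

  value : {k : ℕ} → (Fin k → ℕ) → ℕ
  value {zero}  d = 0
  value {suc k} d = d zero + q * value (d ∘ suc)

  value-cong : {k : ℕ} {d d' : Fin k → ℕ} → (∀ i → d i ≡ d' i) → value d ≡ value d'
  value-cong {zero}  d≗d' = refl
  value-cong {suc k} d≗d' = cong₂ (λ x v → x + q * v) (d≗d' zero) (value-cong (d≗d' ∘ suc))

  value-zero : (k : ℕ) → value {k} (λ _ → 0) ≡ 0
  value-zero zero    = refl
  value-zero (suc k) = trans (cong (q *_) (value-zero k)) (*-zeroʳ q)

  sumFin-powers : {k : ℕ} (d : Fin k → ℕ) (m : ℕ) →
                  sumFin (λ i → d i * (m * q ^ toℕ i)) ≡ m * value d
  sumFin-powers {zero}  d m = sym (*-zeroʳ m)
  sumFin-powers {suc k} d m = begin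
      d zero * (m * 1) + sumFin (λ i → d (suc i) * (m * (q * q ^ toℕ i)))
    ≡⟨ cong (d zero * (m * 1) +_)
            (sumFin-cong (λ i → cong (d (suc i) *_) (sym (*-assoc m q (q ^ toℕ i))))) ⟩
      d zero * (m * 1) + sumFin (λ i → d (suc i) * ((m * q) * q ^ toℕ i))
    ≡⟨ cong (d zero * (m * 1) +_) (sumFin-powers (d ∘ suc) (m * q)) ⟩
      d zero * (m * 1) + (m * q) * value (d ∘ suc)
    ≡⟨ factor (d zero) m q (value (d ∘ suc)) ⟩
      m * (d zero + q * value (d ∘ suc)) ∎
    where
    open ≡-Reasoning
    factor : ∀ x m q v → x * (m * 1) + (m * q) * v ≡ m * (x + q * v)
    factor = solve-∀

  value-last : {n : ℕ} (d : Fin (suc n) → ℕ) →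
               value d ≡ value (d ∘ inject₁) + q ^ n * d (fromℕ n)
  value-last {zero}  d = single (d zero) q
    where
    single : ∀ x q → x + q * 0 ≡ 0 + 1 * x
    single = solve-∀
  value-last {suc n} d rewrite value-last (d ∘ suc) =
    shift (d zero) q (value (d ∘ suc ∘ inject₁)) (q ^ n) (d (fromℕ (suc n)))
    where
    shift : ∀ x q v p y → x + q * (v + p * y) ≡ (x + q * v) + (q * p) * y
    shift = solve-∀

  value-bound : {k : ℕ} (d : Fin k → ℕ) → (∀ i → d i < q) → value d < q ^ k
  value-bound {zero}  d d<q = s≤s z≤n
  value-bound {suc k} d d<q = begin-strict
      d zero + q * value (d ∘ suc)
    <⟨ +-monoˡ-< (q * value (d ∘ suc)) (d<q zero) ⟩
      q + q * value (d ∘ suc)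
    ≡⟨ sym (*-suc q (value (d ∘ suc))) ⟩
      q * suc (value (d ∘ suc))
    ≤⟨ *-monoʳ-≤ q (value-bound (d ∘ suc) (d<q ∘ suc)) ⟩
      q * q ^ k ∎
    where open ≤-Reasoning

  module _ .{{_ : NonZero q}} where

    digit-unique : ∀ a b a' b' → a < q → a' < q → a + q * b ≡ a' + q * b' → a ≡ a' × b ≡ b'
    digit-unique a b a' b' a<q a'<q eq = a≡a' , *-cancelˡ-≡ b b' q (+-cancelˡ-≡ a _ _ eq')
      where
      open ≡-Reasoning
      a≡a' : a ≡ a'
      a≡a' = begin
          a                 ≡⟨ sym (m<n⇒m%n≡m a<q) ⟩
          a % q             ≡⟨ sym ([m+kn]%n≡m%n a b q) ⟩
          (a + b * q) % q   ≡⟨ cong (λ z → (a + z) % q) (*-comm b q) ⟩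
          (a + q * b) % q   ≡⟨ cong (_% q) eq ⟩
          (a' + q * b') % q ≡⟨ cong (λ z → (a' + z) % q) (*-comm q b') ⟩
          (a' + b' * q) % q ≡⟨ [m+kn]%n≡m%n a' b' q ⟩
          a' % q            ≡⟨ m<n⇒m%n≡m a'<q ⟩
          a'                ∎
      eq' : a + q * b ≡ a + q * b'
      eq' = trans eq (cong (_+ q * b') (sym a≡a'))

    value-injective : {k : ℕ} (d d' : Fin k → ℕ) → (∀ i → d i < q) → (∀ i → d' i < q) →
                      value d ≡ value d' → ∀ i → d i ≡ d' i
    value-injective {suc k} d d' d<q d'<q eq zero =
      proj₁ (digit-unique _ _ _ _ (d<q zero) (d'<q zero) eq)
    value-injective {suc k} d d' d<q d'<q eq (suc i) =
      value-injective (d ∘ suc) (d' ∘ suc) (d<q ∘ suc) (d'<q ∘ suc)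
        (proj₂ (digit-unique _ _ _ _ (d<q zero) (d'<q zero) eq)) i

    -- Multiplying by q rotates the digits modulo q^(n+1) − 1.
    value-rotate : {n : ℕ} (d : Fin (suc n) → ℕ) →
                   q * value d ≡ value (rotate d) + d (fromℕ n) * (q ^ suc n ∸ 1)
    value-rotate {n} d = begin
        q * value d
      ≡⟨ cong (q *_) (value-last d) ⟩
        q * (L + q ^ n * x)
      ≡⟨ expand q L (q ^ n) x ⟩
        q * L + (q * q ^ n) * x
      ≡⟨ cong (λ z → q * L + z * x) (sym (suc-pred (q ^ suc n) {{m^n≢0 q (suc n)}})) ⟩
        q * L + suc (q ^ suc n ∸ 1) * x
      ≡⟨ regroup q L x (q ^ suc n ∸ 1) ⟩
        (x + q * L) + x * (q ^ suc n ∸ 1) ∎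
      where
      open ≡-Reasoning
      L = value (d ∘ inject₁)
      x = d (fromℕ n)
      expand : ∀ q L p x → q * (L + p * x) ≡ q * L + (q * p) * x
      expand = solve-∀
      regroup : ∀ q L x N → q * L + suc N * x ≡ (x + q * L) + x * N
      regroup = solve-∀

residue-unique : ∀ {N} a r k x → 0 < a → a < N → r ≤ N → a + k * N ≡ r + x * N → r ≡ a
residue-unique {N} a r k x 0<a a<N r≤N eq = r≡a
  where
  instance N-nz : NonZero N
  N-nz = >-nonZero (≤-<-trans z≤n a<N)
  same-residue : a % N ≡ r % N
  same-residue = trans (sym ([m+kn]%n≡m%n a k N)) (trans (cong (_% N) eq) ([m+kn]%n≡m%n r x N))
  r≡a : r ≡ a
  r≡a with m≤n⇒m<n∨m≡n r≤N
  ... | inj₁ r<N = trans (sym (m<n⇒m%n≡m r<N)) (trans (sym same-residue) (m<n⇒m%n≡m a<N))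
  ... | inj₂ r≡N = ⊥-elim (<-irrefl (sym a≡0) 0<a)
    where
    -- r = N would make a ≡ 0 modulo N, impossible for 0 < a < N.
    a≡0 : a ≡ 0
    a≡0 = trans (sym (m<n⇒m%n≡m a<N)) (trans same-residue (trans (cong (_% N) r≡N) (n%n≡0 N)))

claimed-last : (q m : ℕ) → claimed q (suc (suc m)) (fromℕ (suc m)) ≡ q ∸ 2
claimed-last q m rewrite toℕ-fromℕ m with suc (suc m) ≟ suc (suc m)
... | yes _ = refl
... | no ne = ⊥-elim (ne refl)

claimed-inner : (q m : ℕ) (i : Fin m) → claimed q (suc (suc m)) (suc (inject₁ i)) ≡ 0
claimed-inner q m i rewrite toℕ-inject₁ i with suc (suc (toℕ i)) ≟ suc (suc m)
... | yes eq = ⊥-elim (<-irrefl (suc-injective (suc-injective eq)) (toℕ<n i))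
... | no _  = refl

-- The digits (q − 2, 1, 0, …, 0) of 2(q − 1), for q = t + 2, as an (m + 2)-digit numeral.
twoQMinusTwo : (t m : ℕ) → Fin (suc (suc m)) → ℕ
twoQMinusTwo t m zero          = t
twoQMinusTwo t m (suc zero)    = 1
twoQMinusTwo t m (suc (suc _)) = 0

rotate-claimed : (t m : ℕ) (i : Fin (suc (suc m))) →
                 rotate (claimed (suc (suc t)) (suc (suc m))) i ≡ twoQMinusTwo t m i
rotate-claimed t m zero          = claimed-last (suc (suc t)) m
rotate-claimed t m (suc zero)    = refl
rotate-claimed t m (suc (suc i)) = claimed-inner (suc (suc t)) m i

value-twoQMinusTwo : (t m : ℕ) → value (suc (suc t)) (twoQMinusTwo t m) ≡ 2 * suc t
value-twoQMinusTwo t m =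
  trans (cong (λ v → t + q * (1 + q * v)) (value-zero q m)) (arith t)
  where
  q = suc (suc t)
  arith : ∀ t → t + suc (suc t) * (1 + suc (suc t) * 0) ≡ 2 * suc t
  arith = solve-∀

sumFin-twoQMinusTwo : (t m : ℕ) → sumFin (twoQMinusTwo t m) ≡ suc t
sumFin-twoQMinusTwo t m = trans (cong (λ s → t + suc s) (sumFin-zero m)) (+-comm t 1)

oddPrimePower≥2 : {q : ℕ} → IsOddPrimePower q → 2 ≤ q
oddPrimePower≥2 (p , suc k , p-prime , _ , _ , refl) =
  ≤-trans (nonTrivial⇒n>1 p) (m≤m*n p (p ^ k))
  where instance
          _ = prime⇒nonTrivial p-prime
          _ = prime⇒nonZero p-prime
          _ = m^n≢0 p k

module Solutions (t m : ℕ) where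

  q e N : ℕ
  q = suc (suc t)
  e = suc (suc m)
  N = q ^ e ∸ 1

  q^e≡1+N : q ^ e ≡ suc N
  q^e≡1+N = sym (suc-pred (q ^ e) {{m^n≢0 q e}})

  -- 2(q − 1) < q² ≤ q^e, i.e. 2(q − 1) is a proper residue modulo N.
  2[q-1]<N : 2 * suc t < N
  2[q-1]<N = s≤s⁻¹ (subst (suc (2 * suc t) <_) q^e≡1+N (≤-trans 2q-1<q² q²≤q^e))
    where
    2q-1<q² : suc (suc (2 * suc t)) ≤ q * q
    2q-1<q² = ≤-trans (m≤m+n _ (t * q)) (≤-reflexive (square t))
      where
      square : ∀ t → suc (suc (2 * suc t)) + t * suc (suc t) ≡ suc (suc t) * suc (suc t)
      square = solve-∀
    q²≤q^e : q * q ≤ q ^ e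
    q²≤q^e = *-monoʳ-≤ q (m≤m*n q (q ^ m) {{m^n≢0 q m}})

  shift-identity : (c : Fin e → ℕ) → sumFin c ≡ suc t →
                   weightedSum q c + 2 * suc t ≡ value q (rotate c) + c (fromℕ (suc m)) * N
  shift-identity c Σc = begin
      weightedSum q c + 2 * suc t
    ≡⟨ cong₂ (λ w s → w + 2 * s) (Σ≡sumFin (λ i → c i * (q ^ suc (toℕ i) ∸ 2))) (sym Σc) ⟩
      sumFin (λ i → c i * (q ^ suc (toℕ i) ∸ 2)) + 2 * sumFin c
    ≡⟨ sumFin-weights∸2 c (λ i → q ^ suc (toℕ i)) q^[i+1]≥2 ⟩
      sumFin (λ i → c i * (q * q ^ toℕ i))
    ≡⟨ sumFin-powers q c q ⟩
      q * value q c
    ≡⟨ value-rotate q c ⟩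
      value q (rotate c) + c (fromℕ (suc m)) * N ∎
    where
    open ≡-Reasoning
    q^[i+1]≥2 : (i : Fin e) → 2 ≤ q ^ suc (toℕ i)
    q^[i+1]≥2 i = ≤-trans (s≤s (s≤s z≤n)) (m≤m*n q (q ^ toℕ i) {{m^n≢0 q (toℕ i)}})

  cl : Fin e → ℕ
  cl = claimed q e

  claimed-sum : Σ[ cl ] ≡ q ∸ 1
  claimed-sum = begin
    Σ[ cl ]                   ≡⟨ Σ≡sumFin cl ⟩
    sumFin cl                 ≡⟨ sym (sumFin-rotate cl) ⟩
    sumFin (rotate cl)        ≡⟨ sumFin-cong (rotate-claimed t m) ⟩
    sumFin (twoQMinusTwo t m) ≡⟨ sumFin-twoQMinusTwo t m ⟩
    suc t                     ∎
    where open ≡-Reasoning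

  -- By the key identity, weightedSum q cl + 2(q − 1) = 2(q − 1) + (q − 2) N.
  claimed-divides : N ∣ weightedSum q cl
  claimed-divides = divides t (+-cancelʳ-≡ (2 * suc t) _ _ (begin
      weightedSum q cl + 2 * suc t
    ≡⟨ shift-identity cl (trans (sym (Σ≡sumFin cl)) claimed-sum) ⟩
      value q (rotate cl) + cl (fromℕ (suc m)) * N
    ≡⟨ cong₂ (λ v x → v + x * N) (value-cong q (rotate-claimed t m)) (claimed-last q m) ⟩
      value q (twoQMinusTwo t m) + t * N
    ≡⟨ cong (_+ t * N) (value-twoQMinusTwo t m) ⟩
      2 * suc t + t * N
    ≡⟨ +-comm (2 * suc t) (t * N) ⟩
      t * N + 2 * suc t ∎))
    where open ≡-Reasoning

  -- A solution c has digits ≤ q − 1, so value (rotate c) ≤ N; the residue lemma then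
  -- pins value (rotate c) to 2(q − 1), and uniqueness of digits gives c = cl.
  claimed-unique : (c : Fin e → ℕ) → N ∣ weightedSum q c → Σ[ c ] ≡ q ∸ 1 → ∀ i → c i ≡ cl i
  claimed-unique c (divides k w≡kN) Σc≡q-1 =
    rotate-reflects c cl (λ i → trans (rotate-c≡twoQMinusTwo i) (sym (rotate-claimed t m i)))
    where
    Σc : sumFin c ≡ suc t
    Σc = trans (sym (Σ≡sumFin c)) Σc≡q-1
    c<q : ∀ i → c i < q
    c<q i = s≤s (≤-trans (term≤sumFin c i) (≤-reflexive Σc))
    rotate-c<q : ∀ i → rotate c i < q
    rotate-c<q zero    = c<q _
    rotate-c<q (suc i) = c<q _
    value≤N : value q (rotate c) ≤ N
    value≤N = s≤s⁻¹ (subst (value q (rotate c) <_) q^e≡1+N (value-bound q (rotate c) rotate-c<q))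
    congruence : 2 * suc t + k * N ≡ value q (rotate c) + c (fromℕ (suc m)) * N
    congruence = trans (+-comm (2 * suc t) (k * N))
                   (trans (cong (_+ 2 * suc t) (sym w≡kN)) (shift-identity c Σc))
    value≡ : value q (rotate c) ≡ value q (twoQMinusTwo t m)
    value≡ = trans (residue-unique _ _ k (c (fromℕ (suc m))) (s≤s z≤n) 2[q-1]<N value≤N congruence)
                   (sym (value-twoQMinusTwo t m))
    twoQMinusTwo<q : ∀ i → twoQMinusTwo t m i < q
    twoQMinusTwo<q zero          = <-trans (n<1+n t) (n<1+n (suc t))
    twoQMinusTwo<q (suc zero)    = s≤s (s≤s z≤n)
    twoQMinusTwo<q (suc (suc _)) = s≤s z≤n
    rotate-c≡twoQMinusTwo : ∀ i → rotate c i ≡ twoQMinusTwo t m i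
    rotate-c≡twoQMinusTwo =
      value-injective q (rotate c) (twoQMinusTwo t m) rotate-c<q twoQMinusTwo<q value≡

lemma7p1 : (q e : ℕ) → IsOddPrimePower q → 2 ≤ e →
    (((q ^ e ∸ 1) ∣ weightedSum q (claimed q e)) × (Σ[ claimed q e ] ≡ q ∸ 1))
    × ((c : Fin e → ℕ) →
    (q ^ e ∸ 1) ∣ weightedSum q c → Σ[ c ] ≡ q ∸ 1 →
    (∀ i → c i ≡ claimed q e i))
lemma7p1 q (suc (suc m)) q-oddPrimePower (s≤s (s≤s z≤n))
  with m≤n⇒∃[o]m+o≡n (oddPrimePower≥2 q-oddPrimePower)
... | t , refl = (claimed-divides , claimed-sum) , claimed-unique
  where open Solutions t m
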